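{- Let $n\ge 2$ and consider an urn $U=\{b_1,\dots,b_n\}$ of $n$ labelled, initially uncolored balls and distinct colors $c_0,\dots,c_{n-1}$. Run the following color-assignment process, where $A$ always denotes the set of currently uncolored balls: (0) fix $r\in\{1,\dots,n\}$, paint $b_r$ with $c_0$, set $i=1$, and paint a ball chosen uniformly from $A$ with $c_1$; (1) draw a ball $b$ uniformly from all of $U$ (with replacement): if $b$ is uncolored, paint it with $c_i$; if $b$ is already colored, set $i\leftarrow i+1$ and paint a ball chosen uniformly from $A$ with $c_i$; (2) if $A\ne\varnothing$ repeat (1), otherwise stop. Let $C_i$ be the set (sequence) of balls painted with color $c_i$ (empty if $c_i$ is never used), so $|C_0|=1$. Then for every $i>0$, $k\in\{1,\dots,n-1\}$ and $h\in\{1,\dots,n-k\}$, $$\mathbb{P}\Big(|C_i|=h \,\Big|\, \sum_{j=0}^{i-1}|C_j|=k\Big)=\frac{(k+h)\,(n-k-1)!}{n^{h}\,(n-k-h)!}.$$ -}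

module Defs where

open import Data.Nat as ℕ using (ℕ; zero; suc; _≡ᵇ_; _∸_; _^_)
open import Data.Nat using (_!)
open import Data.Fin using (Fin; _≟_)
open import Data.Bool using (Bool; true; false; if_then_else_; _∧_)
open import Data.Maybe using (Maybe; just; nothing; is-nothing)
open import Data.List using (List; []; _∷_; map; length; filterᵇ; allFin; upTo; concatMap; foldr)
open import Data.Product using (_×_; _,_)
open import Data.Integer using (+_)
open import Data.Rational using (ℚ; 0ℚ; 1ℚ; _+_; _*_; _/_)
open import Relation.Nullary.Decidable using (⌊_⌋)

Dist : Set → Set
Dist A = List (ℚ × A)

return : {A : Set} → A → Dist A
return a = (1ℚ , a) ∷ []

bind : {A B : Set} → Dist A → (A → Dist B) → Dist B
bind d f = concatMap (λ { (p , a) → map (λ { (q , b) → (p * q , b) }) (f a) }) d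

uniform : {A : Set} → List A → Dist A
uniform [] = []
uniform (x ∷ xs) = map (λ y → ((+ 1) / suc (length xs) , y)) (x ∷ xs)

Prob : {A : Set} → Dist A → (A → Bool) → ℚ
Prob d P = foldr (λ { (p , a) acc → (if P a then p else 0ℚ) + acc }) 0ℚ d

-- The urn process. Balls b_1..b_n are Fin n; a colouring assigns to each
-- ball either nothing (uncoloured) or just i (painted with colour c_i).

Coloring : ℕ → Set
Coloring n = Fin n → Maybe ℕ

paint : {n : ℕ} → Coloring n → Fin n → ℕ → Coloring n
paint col b c j = if ⌊ j ≟ b ⌋ then just c else col j

uncolored : {n : ℕ} → Coloring n → List (Fin n)
uncolored {n} col = filterᵇ (λ j → is-nothing (col j)) (allFin n)

mutual
  -- step (1)+(2), with fuel (each step paints one ball, so fuel n suffices)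
  run : {n : ℕ} → ℕ → Coloring n → ℕ → Dist (Coloring n)
  run zero col i = return col
  run {n} (suc f) col i with uncolored col
  ... | [] = return col
  ... | _ ∷ _ = bind (uniform (allFin n)) (λ b → drawn f col i b (col b))

  drawn : {n : ℕ} → ℕ → Coloring n → ℕ → Fin n → Maybe ℕ → Dist (Coloring n)
  drawn f col i b nothing = run f (paint col b i) i
  drawn f col i b (just _) =
    bind (uniform (uncolored col)) (λ a → run f (paint col a (suc i)) (suc i))

process : (n : ℕ) → Fin n → Dist (Coloring n)
process n r =
  bind (uniform (uncolored col₀)) (λ a → run n (paint col₀ a 1) 1)
  where
  col₀ : Coloring n
  col₀ = paint (λ _ → nothing) r 0

hasColor : ℕ → Maybe ℕ → Bool
hasColor i nothing = false
hasColor i (just c) = c ≡ᵇ i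

size : {n : ℕ} → Coloring n → ℕ → ℕ
size {n} col i = length (filterᵇ (λ j → hasColor i (col j)) (allFin n))

prefixSize : {n : ℕ} → Coloring n → ℕ → ℕ
prefixSize col i = foldr ℕ._+_ 0 (map (size col) (upTo i))

-- a / d as a rational; junk value 0 when d = 0 (never used: d ≠ 0 below)
frac : ℕ → ℕ → ℚ
frac a zero = 0ℚ
frac a (suc d) = (+ a) / suc d

formula : ℕ → ℕ → ℕ → ℚ
formula n k h = frac ((k ℕ.+ h) ℕ.* (n ∸ k ∸ 1) !) (n ^ h ℕ.* (n ∸ k ∸ h) !)

{-# OPTIONS --safe #-}
module Submission where

-- Conditioning on Σ_{j<i} |C_j| = k fixes the state at the moment colour c_i is opened: k balls
-- carry the earlier colours, one ball has just been painted c_i, and u = n − k − 1 balls are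
-- uncoloured. While c_i is the current colour, each draw hits an uncoloured ball with probability
-- u/n, which then joins C_i, and otherwise closes C_i for good; later colours never change |C_i|
-- or the prefix sum. So the probability that |C_i| ends at h depends only on u and |C_i| and obeys
-- the recursion of classSizeProb, whose value at |C_i| = 1 is (k+h)(n−k−1)!/(n^h (n−k−h)!).
-- Before c_i is opened, the joint and the conditioning event are driven by the same random steps,
-- so the proportionality P(joint) = formula · P(condition) propagates back to the start of the
-- process by linearity.

open import Defs
open import Data.Bool using (Bool; true; false; T; if_then_else_; not; _∧_)
open import Data.Bool.Properties using (∧-zeroʳ)
open import Data.Fin using (Fin; _≟_)
import Data.Integer as ℤ
import Data.Integer.Properties as ℤ
open import Data.List using (List; []; _∷_; [_]; map; _++_; length; filterᵇ; allFin; upTo)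
open import Data.List.Properties using (upTo-∷ʳ; map-++; length-tabulate; length-filter; filter-all)
open import Data.List.Membership.Propositional using (_∈_)
open import Data.List.Membership.Propositional.Properties using (∈-allFin)
open import Data.List.Relation.Unary.All as All using (All; []; _∷_)
open import Data.List.Relation.Unary.All.Properties using (all-filter)
open import Data.List.Relation.Unary.AllPairs using ([]; _∷_)
open import Data.List.Relation.Unary.Any using (here; there)
open import Data.List.Relation.Unary.Unique.Propositional using (Unique)
open import Data.List.Relation.Unary.Unique.Propositional.Properties using (allFin⁺)
open import Data.Maybe using (Maybe; just; nothing; is-nothing)
open import Data.Nat as ℕ using (ℕ; zero; suc; _≤_; _<_; _∸_; _≡ᵇ_; _^_; _!; NonZero)
import Data.Nat.Properties as ℕ
open import Data.Nat.ListAction using (sum)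
open import Data.Nat.ListAction.Properties using (sum-++)
open import Data.Nat.Solver using () renaming (module +-*-Solver to ℕ-Solver)
open import Data.Product using (_×_; _,_)
open import Data.Rational using (ℚ; 0ℚ; 1ℚ; _+_; _*_; toℚᵘ; fromℚᵘ)
open import Data.Rational.Properties
  using (*-zeroˡ; *-zeroʳ; *-identityˡ; *-identityʳ; +-identityˡ; +-identityʳ; +-assoc; *-assoc; *-comm;
         *-distribˡ-+; /-cong; fromℚᵘ-cong; fromℚᵘ-toℚᵘ; toℚᵘ-fromℚᵘ; toℚᵘ-homo-+; toℚᵘ-homo-*)
open import Data.Rational.Solver using (module +-*-Solver)
import Data.Rational.Unnormalised as ℚᵘ
import Data.Rational.Unnormalised.Properties as ℚᵘ
open import Data.Sum using (inj₁; inj₂)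
open import Function using (id; _∘_; case_of_)
open import Relation.Binary.PropositionalEquality using (_≡_; _≢_; refl; sym; trans; cong; cong₂; subst; module ≡-Reasoning)
open import Relation.Nullary using (yes; no; contradiction)
open import Relation.Nullary.Decidable using (T?; dec-true; dec-false)

fromℚᵘ-homo-* : ∀ p q → fromℚᵘ (p ℚᵘ.* q) ≡ fromℚᵘ p * fromℚᵘ q
fromℚᵘ-homo-* p q = begin
  fromℚᵘ (p ℚᵘ.* q)
    ≡⟨ fromℚᵘ-cong (ℚᵘ.*-cong (ℚᵘ.≃-sym (toℚᵘ-fromℚᵘ p)) (ℚᵘ.≃-sym (toℚᵘ-fromℚᵘ q))) ⟩
  fromℚᵘ (toℚᵘ (fromℚᵘ p) ℚᵘ.* toℚᵘ (fromℚᵘ q))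
    ≡⟨ fromℚᵘ-cong (ℚᵘ.≃-sym (toℚᵘ-homo-* (fromℚᵘ p) (fromℚᵘ q))) ⟩
  fromℚᵘ (toℚᵘ (fromℚᵘ p * fromℚᵘ q))
    ≡⟨ fromℚᵘ-toℚᵘ _ ⟩
  fromℚᵘ p * fromℚᵘ q ∎
  where open ≡-Reasoning

fromℚᵘ-homo-+ : ∀ p q → fromℚᵘ (p ℚᵘ.+ q) ≡ fromℚᵘ p + fromℚᵘ q
fromℚᵘ-homo-+ p q = begin
  fromℚᵘ (p ℚᵘ.+ q)
    ≡⟨ fromℚᵘ-cong (ℚᵘ.+-cong (ℚᵘ.≃-sym (toℚᵘ-fromℚᵘ p)) (ℚᵘ.≃-sym (toℚᵘ-fromℚᵘ q))) ⟩
  fromℚᵘ (toℚᵘ (fromℚᵘ p) ℚᵘ.+ toℚᵘ (fromℚᵘ q))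
    ≡⟨ fromℚᵘ-cong (ℚᵘ.≃-sym (toℚᵘ-homo-+ (fromℚᵘ p) (fromℚᵘ q))) ⟩
  fromℚᵘ (toℚᵘ (fromℚᵘ p + fromℚᵘ q))
    ≡⟨ fromℚᵘ-toℚᵘ _ ⟩
  fromℚᵘ p + fromℚᵘ q ∎
  where open ≡-Reasoning

frac-* : ∀ a b d e → frac a d * frac b e ≡ frac (a ℕ.* b) (d ℕ.* e)
frac-* a b zero    e       = *-zeroˡ (frac b e)
frac-* a b (suc d) zero    rewrite ℕ.*-zeroʳ d = *-zeroʳ (frac a (suc d))
frac-* a b (suc d) (suc e) = trans (sym (fromℚᵘ-homo-* (ℚᵘ.mkℚᵘ (ℤ.+ a) d) (ℚᵘ.mkℚᵘ (ℤ.+ b) e)))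
                                   (/-cong (sym (ℤ.pos-* a b)) refl)

frac-+ : ∀ a b d e → frac a (suc d) + frac b (suc e) ≡ frac (a ℕ.* suc e ℕ.+ b ℕ.* suc d) (suc d ℕ.* suc e)
frac-+ a b d e = trans (sym (fromℚᵘ-homo-+ (ℚᵘ.mkℚᵘ (ℤ.+ a) d) (ℚᵘ.mkℚᵘ (ℤ.+ b) e)))
  (/-cong (trans (cong₂ ℤ._+_ (sym (ℤ.pos-* a (suc e))) (sym (ℤ.pos-* b (suc d))))
                 (sym (ℤ.pos-+ (a ℕ.* suc e) (b ℕ.* suc d)))) refl)

frac-≡ : ∀ {a b d e} .{{_ : NonZero d}} .{{_ : NonZero e}} → a ℕ.* e ≡ b ℕ.* d → frac a d ≡ frac b e
frac-≡ {a} {b} {suc d} {suc e} ae≡bd = fromℚᵘ-cong {ℚᵘ.mkℚᵘ (ℤ.+ a) d} {ℚᵘ.mkℚᵘ (ℤ.+ b) e}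
  (ℚᵘ.*≡* (trans (sym (ℤ.pos-* a (suc e))) (trans (cong ℤ.+_ ae≡bd) (ℤ.pos-* b (suc d)))))

frac-suc : ∀ a → frac (suc a) 1 ≡ 1ℚ + frac a 1
frac-suc a = sym (trans (frac-+ 1 a 0 0) (cong (λ b → frac (suc b) 1) (ℕ.*-identityʳ a)))

frac-self : ∀ {a d} .{{_ : NonZero d}} → a ≡ d → frac a d ≡ 1ℚ
frac-self {a} {d} a≡d = frac-≡ {a} {1} {d} {1} (trans (ℕ.*-identityʳ a) (trans a≡d (sym (ℕ.*-identityˡ d))))

frac-1-* : ∀ a d X → frac 1 d * (frac a 1 * X) ≡ frac a d * X
frac-1-* a d X = begin
  frac 1 d * (frac a 1 * X)     ≡⟨ *-assoc (frac 1 d) (frac a 1) X ⟨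
  frac 1 d * frac a 1 * X       ≡⟨ cong (_* X) (frac-* 1 a d 1) ⟩
  frac (1 ℕ.* a) (d ℕ.* 1) * X  ≡⟨ cong (λ e → frac (1 ℕ.* a) e * X) (ℕ.*-identityʳ d) ⟩
  frac (1 ℕ.* a) d * X          ≡⟨ cong (λ e → frac e d * X) (ℕ.*-identityˡ a) ⟩
  frac a d * X                  ∎
  where open ≡-Reasoning

≡ᵇ-refl : ∀ c → (c ≡ᵇ c) ≡ true
≡ᵇ-refl c = dec-true (c ℕ.≟ c) refl

≢⇒≡ᵇ≡false : ∀ {c d} → d ≢ c → (d ≡ᵇ c) ≡ false
≢⇒≡ᵇ≡false {c} {d} d≢c = dec-false (d ℕ.≟ c) d≢c

ind : Bool → ℚ
ind b = if b then 1ℚ else 0ℚ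

ind-∧ : ∀ a b → ind (a ∧ b) ≡ ind a * ind b
ind-∧ true  b = sym (*-identityˡ (ind b))
ind-∧ false b = sym (*-zeroˡ (ind b))

ind-guarded : ∀ b {x y} → (b ≡ true → x ≡ y) → ind b * x ≡ y * ind b
ind-guarded true  {x} {y} x≡y = trans (*-identityˡ x) (trans (x≡y refl) (sym (*-identityʳ y)))
ind-guarded false {x} {y} _   = trans (*-zeroˡ x) (sym (*-zeroʳ y))

∑ : {A : Set} → List A → (A → ℚ) → ℚ
∑ []       g = 0ℚ
∑ (x ∷ xs) g = g x + ∑ xs g

module _ {A : Set} where

  ∑-cong : ∀ {g g′ : A → ℚ} {xs} → All (λ x → g x ≡ g′ x) xs → ∑ xs g ≡ ∑ xs g′
  ∑-cong []         = refl
  ∑-cong (eq ∷ eqs) = cong₂ _+_ eq (∑-cong eqs)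

  ∑-*ˡ : ∀ c (g : A → ℚ) xs → ∑ xs (λ x → c * g x) ≡ c * ∑ xs g
  ∑-*ˡ c g []       = sym (*-zeroʳ c)
  ∑-*ˡ c g (x ∷ xs) = trans (cong ((c * g x) +_) (∑-*ˡ c g xs)) (sym (*-distribˡ-+ c (g x) (∑ xs g)))

  ∑-const : ∀ c (xs : List A) → ∑ xs (λ _ → c) ≡ frac (length xs) 1 * c
  ∑-const c []       = sym (*-zeroˡ c)
  ∑-const c (x ∷ xs) = begin
    c + ∑ xs (λ _ → c)            ≡⟨ cong (c +_) (∑-const c xs) ⟩
    c + a * c                     ≡⟨ solve 2 (λ c a → c :+ a :* c := (con 1ℚ :+ a) :* c) refl c a ⟩
    (1ℚ + a) * c                  ≡⟨ cong (_* c) (sym (frac-suc (length xs))) ⟩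
    frac (suc (length xs)) 1 * c  ∎
    where
    open ≡-Reasoning
    open +-*-Solver
    a = frac (length xs) 1

count : {A : Set} → (A → Bool) → List A → ℕ
count p xs = length (filterᵇ p xs)

module _ {A : Set} where

  ∑-if : ∀ (p : A → Bool) X Y xs →
         ∑ xs (λ x → if p x then X else Y) ≡ frac (count p xs) 1 * X + frac (count (not ∘ p) xs) 1 * Y
  ∑-if p X Y []       = sym (trans (cong₂ _+_ (*-zeroˡ X) (*-zeroˡ Y)) (+-identityʳ 0ℚ))
  ∑-if p X Y (x ∷ xs) with p x
  ... | true  = begin
    X + ∑ xs _                  ≡⟨ cong (X +_) (∑-if p X Y xs) ⟩
    X + (a * X + b * Y)         ≡⟨ solve 4 (λ X Y a b → X :+ (a :* X :+ b :* Y) := (con 1ℚ :+ a) :* X :+ b :* Y) refl X Y a b ⟩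
    (1ℚ + a) * X + b * Y        ≡⟨ cong (λ z → z * X + b * Y) (sym (frac-suc (count p xs))) ⟩
    frac (suc (count p xs)) 1 * X + b * Y ∎
    where
    open ≡-Reasoning
    open +-*-Solver
    a = frac (count p xs) 1
    b = frac (count (not ∘ p) xs) 1
  ... | false = begin
    Y + ∑ xs _                  ≡⟨ cong (Y +_) (∑-if p X Y xs) ⟩
    Y + (a * X + b * Y)         ≡⟨ solve 4 (λ X Y a b → Y :+ (a :* X :+ b :* Y) := a :* X :+ (con 1ℚ :+ b) :* Y) refl X Y a b ⟩
    a * X + (1ℚ + b) * Y        ≡⟨ cong (λ z → a * X + z * Y) (sym (frac-suc (count (not ∘ p) xs))) ⟩
    a * X + frac (suc (count (not ∘ p) xs)) 1 * Y ∎
    where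
    open ≡-Reasoning
    open +-*-Solver
    a = frac (count p xs) 1
    b = frac (count (not ∘ p) xs) 1

  count-cong : ∀ {p q : A → Bool} {xs} → All (λ x → p x ≡ q x) xs → count p xs ≡ count q xs
  count-cong {xs = []}     []           = refl
  count-cong {q = q} {x ∷ xs} (px≡qx ∷ eqs) rewrite px≡qx with q x
  ... | true  = cong suc (count-cong eqs)
  ... | false = count-cong eqs

  count-none : ∀ {p : A → Bool} xs → (∀ x → p x ≡ false) → count p xs ≡ 0
  count-none []       never = refl
  count-none (x ∷ xs) never rewrite never x = count-none xs never

  count+count-not : ∀ (p : A → Bool) xs → count p xs ℕ.+ count (not ∘ p) xs ≡ length xs
  count+count-not p []       = refl
  count+count-not p (x ∷ xs) with p x
  ... | true  = cong suc (count+count-not p xs)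
  ... | false = trans (ℕ.+-suc _ _) (cong suc (count+count-not p xs))

  count-flip : ∀ {p q : A → Bool} {b xs} → Unique xs → b ∈ xs →
               (∀ x → x ≢ b → p x ≡ q x) → p b ≡ true → q b ≡ false →
               count p xs ≡ suc (count q xs)
  count-flip {p} {q} (b∉xs ∷ _) (here refl) agree pb qb rewrite pb | qb =
    cong suc (count-cong (All.map (λ x≢b → agree _ (x≢b ∘ sym)) b∉xs))
  count-flip {p} {q} {b} {x ∷ xs} (x∉xs ∷ unique) (there b∈xs) agree pb qb
    rewrite agree x (All.lookup x∉xs b∈xs) with q x
  ... | true  = cong suc (count-flip unique b∈xs agree pb qb)
  ... | false = count-flip unique b∈xs agree pb qb

  mean-if : ∀ (p : A → Bool) X Y xs →
            frac 1 (length xs) * ∑ xs (λ x → if p x then X else Y)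
              ≡ frac (count p xs) (length xs) * X + frac (length xs ∸ count p xs) (length xs) * Y
  mean-if p X Y xs = begin
    w * ∑ xs (λ x → if p x then X else Y)
      ≡⟨ cong (w *_) (∑-if p X Y xs) ⟩
    w * (frac (count p xs) 1 * X + frac (count (not ∘ p) xs) 1 * Y)
      ≡⟨ *-distribˡ-+ w _ _ ⟩
    w * (frac (count p xs) 1 * X) + w * (frac (count (not ∘ p) xs) 1 * Y)
      ≡⟨ cong₂ _+_ (frac-1-* (count p xs) (length xs) X) (frac-1-* (count (not ∘ p) xs) (length xs) Y) ⟩
    frac (count p xs) (length xs) * X + frac (count (not ∘ p) xs) (length xs) * Y
      ≡⟨ cong (λ c → frac (count p xs) (length xs) * X + frac c (length xs) * Y) count-not≡ ⟩
    frac (count p xs) (length xs) * X + frac (length xs ∸ count p xs) (length xs) * Y ∎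
    where
    open ≡-Reasoning
    w = frac 1 (length xs)
    count-not≡ : count (not ∘ p) xs ≡ length xs ∸ count p xs
    count-not≡ = trans (sym (ℕ.m+n∸m≡n (count p xs) _)) (cong (_∸ count p xs) (count+count-not p xs))

module _ {A : Set} (P : A → Bool) where

  Prob-return : ∀ a → Prob (return a) P ≡ ind (P a)
  Prob-return a = +-identityʳ (ind (P a))

  Prob-++ : ∀ d d′ → Prob (d ++ d′) P ≡ Prob d P + Prob d′ P
  Prob-++ []            d′ = sym (+-identityˡ (Prob d′ P))
  Prob-++ ((p , a) ∷ d) d′ = trans (cong (pₐ +_) (Prob-++ d d′)) (sym (+-assoc pₐ (Prob d P) (Prob d′ P)))
    where pₐ = if P a then p else 0ℚ

  Prob-scale : ∀ w (φ : ℚ × A → ℚ × A) → (∀ q a → φ (q , a) ≡ (w * q , a)) →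
               ∀ d → Prob (map φ d) P ≡ w * Prob d P
  Prob-scale w φ φ-scales []            = sym (*-zeroʳ w)
  Prob-scale w φ φ-scales ((q , a) ∷ d) rewrite φ-scales q a with P a
  ... | true  = trans (cong ((w * q) +_) (Prob-scale w φ φ-scales d)) (sym (*-distribˡ-+ w q (Prob d P)))
  ... | false = trans (+-identityˡ _) (trans (Prob-scale w φ φ-scales d) (cong (w *_) (sym (+-identityˡ (Prob d P)))))

module _ {A B : Set} (P : B → Bool) where

  Prob-bind-uniform : ∀ (xs : List A) f → Prob (bind (uniform xs) f) P ≡ frac 1 (length xs) * ∑ xs (λ x → Prob (f x) P)
  Prob-bind-uniform []       f = sym (*-zeroʳ (frac 1 0))
  Prob-bind-uniform (y ∷ ys) f = weighted (y ∷ ys)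
    where
    w = frac 1 (length (y ∷ ys))
    weighted : ∀ xs → Prob (bind (map (λ x → (w , x)) xs) f) P ≡ w * ∑ xs (λ x → Prob (f x) P)
    weighted []       = sym (*-zeroʳ w)
    weighted (x ∷ xs) = begin
      Prob (map _ (f x) ++ bind (map (λ x → (w , x)) xs) f) P
        ≡⟨ Prob-++ P (map _ (f x)) _ ⟩
      Prob (map _ (f x)) P + Prob (bind (map (λ x → (w , x)) xs) f) P
        ≡⟨ cong₂ _+_ (Prob-scale P w _ (λ _ _ → refl) (f x)) (weighted xs) ⟩
      w * Prob (f x) P + w * ∑ xs (λ x → Prob (f x) P)
        ≡⟨ sym (*-distribˡ-+ w _ _) ⟩
      w * ∑ (x ∷ xs) (λ x → Prob (f x) P) ∎
      where open ≡-Reasoning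

  Prob-bind-uniform-const : ∀ {xs : List A} {f v} → xs ≢ [] → All (λ x → Prob (f x) P ≡ v) xs →
                            Prob (bind (uniform xs) f) P ≡ v
  Prob-bind-uniform-const {[]}     xs≢[] _       = contradiction refl xs≢[]
  Prob-bind-uniform-const {y ∷ ys} {f} {v} _ all-v = begin
    Prob (bind (uniform (y ∷ ys)) f) P          ≡⟨ Prob-bind-uniform (y ∷ ys) f ⟩
    frac 1 l * ∑ (y ∷ ys) (λ x → Prob (f x) P)  ≡⟨ cong (frac 1 l *_) (trans (∑-cong all-v) (∑-const v (y ∷ ys))) ⟩
    frac 1 l * (frac l 1 * v)                   ≡⟨ sym (*-assoc (frac 1 l) (frac l 1) v) ⟩
    frac 1 l * frac l 1 * v                     ≡⟨ cong (_* v) (trans (frac-* 1 l l 1) (frac-self (ℕ.*-comm 1 l))) ⟩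
    1ℚ * v                                      ≡⟨ *-identityˡ v ⟩
    v ∎
    where
    open ≡-Reasoning
    l = suc (length ys)

module _ {A B : Set} (E F : B → Bool) (c : ℚ) where

  Prob-bind-uniform-∝ : ∀ {xs : List A} {f} → All (λ x → Prob (f x) E ≡ c * Prob (f x) F) xs →
                        Prob (bind (uniform xs) f) E ≡ c * Prob (bind (uniform xs) f) F
  Prob-bind-uniform-∝ {xs} {f} all-∝ = begin
    Prob (bind (uniform xs) f) E                     ≡⟨ Prob-bind-uniform E xs f ⟩
    w * ∑ xs (λ x → Prob (f x) E)                    ≡⟨ cong (w *_) (trans (∑-cong all-∝) (∑-*ˡ c _ xs)) ⟩
    w * (c * ∑ xs (λ x → Prob (f x) F))              ≡⟨ solve 3 (λ w c s → w :* (c :* s) := c :* (w :* s)) refl w c _ ⟩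
    c * (w * ∑ xs (λ x → Prob (f x) F))              ≡⟨ cong (c *_) (sym (Prob-bind-uniform F xs f)) ⟩
    c * Prob (bind (uniform xs) f) F ∎
    where
    open ≡-Reasoning
    open +-*-Solver
    w = frac 1 (length xs)

module _ {n : ℕ} where

  paint-self : ∀ (col : Coloring n) b c → paint col b c b ≡ just c
  paint-self col b c with b ≟ b
  ... | yes _   = refl
  ... | no b≢b = contradiction refl b≢b

  paint-other : ∀ (col : Coloring n) b c {x} → x ≢ b → paint col b c x ≡ col x
  paint-other col b c {x} x≢b with x ≟ b
  ... | yes x≡b = contradiction x≡b x≢b
  ... | no _    = refl

  size-paint-self : ∀ {col : Coloring n} {b} c → col b ≡ nothing → size (paint col b c) c ≡ suc (size col c)
  size-paint-self {col} {b} c b-blank = count-flip (allFin⁺ n) (∈-allFin b)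
    (λ x x≢b → cong (hasColor c) (paint-other col b c x≢b))
    (trans (cong (hasColor c) (paint-self col b c)) (≡ᵇ-refl c))
    (cong (hasColor c) b-blank)

  size-paint-other : ∀ {col : Coloring n} {b} {c d} → col b ≡ nothing → d ≢ c → size (paint col b d) c ≡ size col c
  size-paint-other {col} {b} {c} {d} b-blank d≢c = count-cong {xs = allFin n} (All.tabulate (λ {x} _ → unchanged x))
    where
    unchanged : ∀ x → hasColor c (paint col b d x) ≡ hasColor c (col x)
    unchanged x with x ≟ b
    ... | yes refl = trans (≢⇒≡ᵇ≡false d≢c) (sym (cong (hasColor c) b-blank))
    ... | no x≢b   = refl

  length-uncolored-paint : ∀ {col : Coloring n} {b} d → col b ≡ nothing →
                           length (uncolored col) ≡ suc (length (uncolored (paint col b d)))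
  length-uncolored-paint {col} {b} d b-blank = count-flip (allFin⁺ n) (∈-allFin b)
    (λ x x≢b → cong is-nothing (sym (paint-other col b d x≢b)))
    (cong is-nothing b-blank)
    (cong is-nothing (paint-self col b d))

  uncolored-blank : ∀ (col : Coloring n) → All (λ a → col a ≡ nothing) (uncolored col)
  uncolored-blank col = All.map T-is-nothing (all-filter (T? ∘ (λ a → is-nothing (col a))) (allFin n))
    where
    T-is-nothing : ∀ {m : Maybe ℕ} → T (is-nothing m) → m ≡ nothing
    T-is-nothing {nothing} _ = refl

  prefixSize-suc : ∀ (col : Coloring n) j → prefixSize col (suc j) ≡ prefixSize col j ℕ.+ size col j
  prefixSize-suc col j = begin
    sum (map (size col) (upTo (suc j)))              ≡⟨ cong (sum ∘ map (size col)) (upTo-∷ʳ j) ⟨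
    sum (map (size col) (upTo j ++ [ j ]))           ≡⟨ cong sum (map-++ (size col) (upTo j) [ j ]) ⟩
    sum (map (size col) (upTo j) ++ [ size col j ])  ≡⟨ sum-++ (map (size col) (upTo j)) [ size col j ] ⟩
    prefixSize col j ℕ.+ (size col j ℕ.+ 0)          ≡⟨ cong (prefixSize col j ℕ.+_) (ℕ.+-identityʳ (size col j)) ⟩
    prefixSize col j ℕ.+ size col j                  ∎
    where open ≡-Reasoning

  prefixSize-paint-≥ : ∀ {col : Coloring n} {b d} → col b ≡ nothing → ∀ J → J ≤ d →
                       prefixSize (paint col b d) J ≡ prefixSize col J
  prefixSize-paint-≥ b-blank zero    _     = refl
  prefixSize-paint-≥ {col} {b} {d} b-blank (suc J) J<d = begin
    prefixSize (paint col b d) (suc J)                      ≡⟨ prefixSize-suc (paint col b d) J ⟩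
    prefixSize (paint col b d) J ℕ.+ size (paint col b d) J ≡⟨ cong₂ ℕ._+_ (prefixSize-paint-≥ b-blank J (ℕ.<⇒≤ J<d))
                                                                             (size-paint-other b-blank (ℕ.>⇒≢ J<d)) ⟩
    prefixSize col J ℕ.+ size col J                         ≡⟨ prefixSize-suc col J ⟨
    prefixSize col (suc J)                                  ∎
    where open ≡-Reasoning

  prefixSize-paint-< : ∀ {col : Coloring n} {b d} → col b ≡ nothing → ∀ J → d < J →
                       prefixSize (paint col b d) J ≡ suc (prefixSize col J)
  prefixSize-paint-< {col} {b} {d} b-blank (suc J) d<1+J
    rewrite prefixSize-suc (paint col b d) J | prefixSize-suc col J with ℕ.m<1+n⇒m<n∨m≡n d<1+J
  ... | inj₁ d<J  = cong₂ ℕ._+_ (prefixSize-paint-< b-blank J d<J) (size-paint-other b-blank (ℕ.<⇒≢ d<J))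
  ... | inj₂ refl = trans (cong₂ ℕ._+_ (prefixSize-paint-≥ b-blank J ℕ.≤-refl) (size-paint-self d b-blank))
                          (ℕ.+-suc (prefixSize col d) (size col d))

  ColoursBelow : Coloring n → ℕ → Set
  ColoursBelow col J = ∀ x {c} → col x ≡ just c → c < J

  ColoursBelow-mono : ∀ {col : Coloring n} {J J′} → J ≤ J′ → ColoursBelow col J → ColoursBelow col J′
  ColoursBelow-mono J≤J′ below x eq = ℕ.<-≤-trans (below x eq) J≤J′

  ColoursBelow-paint : ∀ {col : Coloring n} {b d J} → d < J → ColoursBelow col J → ColoursBelow (paint col b d) J
  ColoursBelow-paint {col} {b} {d} d<J below x eq with x ≟ b
  ... | yes _ with refl ← eq = d<J
  ... | no _  = below x eq

  size-≥ : ∀ {col : Coloring n} {J c} → ColoursBelow col J → J ≤ c → size col c ≡ 0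
  size-≥ {col} {J} {c} below J≤c = count-none (allFin n) absent
    where
    absent : ∀ x → hasColor c (col x) ≡ false
    absent x with col x in eq
    ... | nothing = refl
    ... | just d  = ≢⇒≡ᵇ≡false (ℕ.<⇒≢ (ℕ.<-≤-trans (below x eq) J≤c))

  prefixSize-≥ : ∀ {col : Coloring n} {J} → ColoursBelow col J → ∀ t → prefixSize col (t ℕ.+ J) ≡ prefixSize col J
  prefixSize-≥ below zero    = refl
  prefixSize-≥ {col} {J} below (suc t) = begin
    prefixSize col (suc t ℕ.+ J)                           ≡⟨ prefixSize-suc col (t ℕ.+ J) ⟩
    prefixSize col (t ℕ.+ J) ℕ.+ size col (t ℕ.+ J)        ≡⟨ cong₂ ℕ._+_ (prefixSize-≥ below t) (size-≥ below (ℕ.m≤n+m J t)) ⟩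
    prefixSize col J ℕ.+ 0                                 ≡⟨ ℕ.+-identityʳ (prefixSize col J) ⟩
    prefixSize col J                                       ∎
    where open ≡-Reasoning

  Partition : Coloring n → ℕ → Set
  Partition col J = prefixSize col J ℕ.+ length (uncolored col) ≡ n

  Partition-paint : ∀ {col : Coloring n} {b d J} → col b ≡ nothing → d < J → Partition col J → Partition (paint col b d) J
  Partition-paint {col} {b} {d} {J} b-blank d<J partition = begin
    prefixSize (paint col b d) J ℕ.+ length (uncolored (paint col b d))
      ≡⟨ cong (ℕ._+ length (uncolored (paint col b d))) (prefixSize-paint-< b-blank J d<J) ⟩
    suc (prefixSize col J) ℕ.+ length (uncolored (paint col b d))
      ≡⟨ ℕ.+-suc (prefixSize col J) _ ⟨
    prefixSize col J ℕ.+ suc (length (uncolored (paint col b d)))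
      ≡⟨ cong (prefixSize col J ℕ.+_) (length-uncolored-paint d b-blank) ⟨
    prefixSize col J ℕ.+ length (uncolored col)
      ≡⟨ partition ⟩
    n ∎
    where open ≡-Reasoning

  length-uncolored-paint-≤ : ∀ {col : Coloring n} {b} d {f} → col b ≡ nothing →
                             length (uncolored col) ≤ suc f → length (uncolored (paint col b d)) ≤ f
  length-uncolored-paint-≤ d b-blank fuel = ℕ.s≤s⁻¹ (subst (_≤ _) (length-uncolored-paint d b-blank) fuel)

  Partition-≥ : ∀ {col : Coloring n} {J} → ColoursBelow col J → Partition col J → ∀ t → Partition col (t ℕ.+ J)
  Partition-≥ {col} below partition t = trans (cong (ℕ._+ length (uncolored col)) (prefixSize-≥ below t)) partition

-- Events unaffected by later paintings

-- Step (1) after drawing a coloured ball; `drawn f col j b (just c)` and `process n r` both unfold to it.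
openColour : {n : ℕ} → ℕ → Coloring n → ℕ → Dist (Coloring n)
openColour f col j = bind (uniform (uncolored col)) (λ a → run f (paint col a (suc j)) (suc j))

allFin≢[] : ∀ {n} → Fin n → allFin n ≢ []
allFin≢[] {suc n} _ ()

PaintStable : {n : ℕ} → (Coloring n → Bool) → ℕ → Set
PaintStable {n} P j = ∀ (col : Coloring n) b d → col b ≡ nothing → j ≤ d → P (paint col b d) ≡ P col

PaintStable-suc : ∀ {n} {P : Coloring n → Bool} {j} → PaintStable P j → PaintStable P (suc j)
PaintStable-suc stable col b d b-blank j<d = stable col b d b-blank (ℕ.<⇒≤ j<d)

module _ {n : ℕ} {P : Coloring n → Bool} where

  mutual
    run-stable : ∀ {j} → PaintStable P j → ∀ f col → Prob (run f col j) P ≡ ind (P col)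
    run-stable stable zero    col = Prob-return P col
    run-stable {j} stable (suc f) col with uncolored col in eq
    ... | []    = Prob-return P col
    ... | x ∷ _ = Prob-bind-uniform-const P (allFin≢[] x) (All.tabulate (λ {b} _ → drawn-stable b))
      where
      drawn-stable : ∀ b → Prob (drawn f col j b (col b)) P ≡ ind (P col)
      drawn-stable b with col b in b-colour
      ... | nothing = trans (run-stable stable f (paint col b j)) (cong ind (stable col b j b-colour ℕ.≤-refl))
      ... | just _  = openColour-stable (PaintStable-suc stable) f col (λ u≡[] → case trans (sym eq) u≡[] of λ ())

    openColour-stable : ∀ {j} → PaintStable P (suc j) → ∀ f col → uncolored col ≢ [] →
                        Prob (openColour f col j) P ≡ ind (P col)
    openColour-stable {j} stable f col nonempty = Prob-bind-uniform-const P nonempty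
      (All.map (λ {a} a-blank → trans (run-stable stable f (paint col a (suc j)))
                                      (cong ind (stable col a (suc j) a-blank ℕ.≤-refl)))
               (uncolored-blank col))

-- The size of the class being painted

-- Probability that the class being painted ends with exactly h balls, given that it has s balls
-- and that u balls are still uncoloured.
classSizeProb : (n h u s : ℕ) → ℚ
classSizeProb n h zero    s = ind (s ≡ᵇ h)
classSizeProb n h (suc u) s = frac (suc u) n * classSizeProb n h u (suc s) + frac (n ∸ suc u) n * ind (s ≡ᵇ h)

classSizeProb-above : ∀ n h u s → h < s → classSizeProb n h u s ≡ 0ℚ
classSizeProb-above n h zero    s h<s = cong ind (≢⇒≡ᵇ≡false (ℕ.>⇒≢ h<s))
classSizeProb-above n h (suc u) s h<s
  rewrite classSizeProb-above n h u (suc s) (ℕ.m<n⇒m<1+n h<s) | ≢⇒≡ᵇ≡false (ℕ.>⇒≢ h<s)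
        | *-zeroʳ (frac (suc u) n) | *-zeroʳ (frac (n ∸ suc u) n) = +-identityʳ 0ℚ

-- t more uncoloured draws, with probability u(u−1)⋯(u−t+1)/n^t, then a coloured one, with
-- probability (n−u+t)/n.
classSizeProb-closed : ∀ n h u t s .{{_ : NonZero n}} → u < n → t ≤ u → s ℕ.+ t ≡ h →
                       classSizeProb n h u s ≡ frac ((n ∸ u ℕ.+ t) ℕ.* u !) (n ^ suc t ℕ.* (u ∸ t) !)
classSizeProb-closed n h zero zero s _ _ s+0≡h
  rewrite sym (trans (sym (ℕ.+-identityʳ s)) s+0≡h) | ≡ᵇ-refl s =
  sym (frac-self (solve 1 (λ n → (n :+ con 0) :* con 1 := n :* con 1 :* con 1) refl n))
  where
  open ℕ-Solver
  instance
    denominator≢0 : NonZero (n ^ 1 ℕ.* 1)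
    denominator≢0 = ℕ.m*n≢0 (n ^ 1) 1 {{ℕ.m^n≢0 n 1}}
classSizeProb-closed n h (suc u) zero s u<n _ s+0≡h
  rewrite sym (trans (sym (ℕ.+-identityʳ s)) s+0≡h) | ≡ᵇ-refl s
        | classSizeProb-above n s u (suc s) (ℕ.n<1+n s)
        | *-zeroʳ (frac (suc u) n) | *-identityʳ (frac (n ∸ suc u) n) | +-identityˡ (frac (n ∸ suc u) n) =
  frac-≡ (solve 3 (λ a n F → a :* (n :* con 1 :* F) := (a :+ con 0) :* F :* n) refl (n ∸ suc u) n (suc u !))
  where
  open ℕ-Solver
  instance
    denominator≢0 : NonZero (n ^ 1 ℕ.* suc u !)
    denominator≢0 = ℕ.m*n≢0 (n ^ 1) (suc u !) {{ℕ.m^n≢0 n 1}} {{suc u ℕ.!≢0}}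
classSizeProb-closed n h (suc u) (suc t) s u<n t≤u s+t≡h = begin
  frac (suc u) n * classSizeProb n h u (suc s) + frac (n ∸ suc u) n * ind (s ≡ᵇ h)
    ≡⟨ cong (λ b → frac (suc u) n * classSizeProb n h u (suc s) + frac (n ∸ suc u) n * ind b) (≢⇒≡ᵇ≡false s≢h) ⟩
  frac (suc u) n * classSizeProb n h u (suc s) + frac (n ∸ suc u) n * 0ℚ
    ≡⟨ trans (cong (frac (suc u) n * classSizeProb n h u (suc s) +_) (*-zeroʳ (frac (n ∸ suc u) n))) (+-identityʳ _) ⟩
  frac (suc u) n * classSizeProb n h u (suc s)
    ≡⟨ cong (frac (suc u) n *_) (classSizeProb-closed n h u t (suc s) (ℕ.<-trans (ℕ.n<1+n u) u<n) (ℕ.s≤s⁻¹ t≤u) (trans (sym (ℕ.+-suc s t)) s+t≡h)) ⟩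
  frac (suc u) n * frac ((n ∸ u ℕ.+ t) ℕ.* u !) (n ^ suc t ℕ.* (u ∸ t) !)
    ≡⟨ frac-* (suc u) _ n _ ⟩
  frac (suc u ℕ.* ((n ∸ u ℕ.+ t) ℕ.* u !)) (n ℕ.* (n ^ suc t ℕ.* (u ∸ t) !))
    ≡⟨ cong₂ frac numerator (sym (ℕ.*-assoc n (n ^ suc t) ((u ∸ t) !))) ⟩
  frac ((n ∸ suc u ℕ.+ suc t) ℕ.* suc u !) (n ^ suc (suc t) ℕ.* (suc u ∸ suc t) !) ∎
  where
  open ≡-Reasoning
  s≢h : s ≢ h
  s≢h = ℕ.<⇒≢ (subst (s <_) s+t≡h (ℕ.m<m+n s ℕ.z<s))
  n∸u≡ : n ∸ u ℕ.+ t ≡ n ∸ suc u ℕ.+ suc t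
  n∸u≡ = trans (cong (ℕ._+ t) (ℕ.+-∸-assoc 1 (ℕ.<⇒≤ u<n))) (sym (ℕ.+-suc (n ∸ suc u) t))
  numerator : suc u ℕ.* ((n ∸ u ℕ.+ t) ℕ.* u !) ≡ (n ∸ suc u ℕ.+ suc t) ℕ.* suc u !
  numerator rewrite n∸u≡ = solve 3 (λ x a f → x :* (a :* f) := a :* (x :* f)) refl (suc u) (n ∸ suc u ℕ.+ suc t) (u !)
    where open ℕ-Solver

classSizeProb≡formula : ∀ n k h u .{{_ : NonZero n}} → k ℕ.+ suc u ≡ n → 0 < h → h ≤ n ∸ k →
                        classSizeProb n h u 1 ≡ formula n k h
classSizeProb≡formula n k (suc t) u k+1+u≡n _ h≤n∸k = begin
  classSizeProb n (suc t) u 1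
    ≡⟨ classSizeProb-closed n (suc t) u t 1 u<n (ℕ.s≤s⁻¹ (subst (suc t ≤_) n∸k≡1+u h≤n∸k)) refl ⟩
  frac ((n ∸ u ℕ.+ t) ℕ.* u !) (n ^ suc t ℕ.* (u ∸ t) !)
    ≡⟨ cong₂ frac (cong₂ (λ a m → a ℕ.* m !) n∸u+t≡k+1+t (sym (cong (_∸ 1) n∸k≡1+u)))
                  (cong (λ m → n ^ suc t ℕ.* m !) (sym (cong (_∸ suc t) n∸k≡1+u))) ⟩
  formula n k (suc t) ∎
  where
  open ≡-Reasoning
  u<n : u < n
  u<n = ℕ.≤-trans (ℕ.m≤n+m (suc u) k) (ℕ.≤-reflexive k+1+u≡n)
  n∸k≡1+u : n ∸ k ≡ suc u
  n∸k≡1+u = trans (cong (_∸ k) (sym k+1+u≡n)) (ℕ.m+n∸m≡n k (suc u))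
  n∸u+t≡k+1+t : n ∸ u ℕ.+ t ≡ k ℕ.+ suc t
  n∸u+t≡k+1+t = begin
    n ∸ u ℕ.+ t                ≡⟨ cong (λ m → m ∸ u ℕ.+ t) (sym k+1+u≡n) ⟩
    k ℕ.+ suc u ∸ u ℕ.+ t      ≡⟨ cong (λ m → m ∸ u ℕ.+ t) (ℕ.+-suc k u) ⟩
    suc k ℕ.+ u ∸ u ℕ.+ t      ≡⟨ cong (ℕ._+ t) (ℕ.m+n∸n≡m (suc k) u) ⟩
    suc k ℕ.+ t                ≡⟨ ℕ.+-suc k t ⟨
    k ℕ.+ suc t                ∎

module Events {n : ℕ} (i k h : ℕ) where

  prefix≡k : Coloring n → Bool
  prefix≡k col = prefixSize col i ≡ᵇ k

  size≡h∧prefix≡k : Coloring n → Bool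
  size≡h∧prefix≡k col = (size col i ≡ᵇ h) ∧ prefix≡k col

  prefix≡k-stable : PaintStable prefix≡k i
  prefix≡k-stable col b d b-blank i≤d = cong (_≡ᵇ k) (prefixSize-paint-≥ {col = col} b-blank i i≤d)

  size≡h∧prefix≡k-stable : PaintStable size≡h∧prefix≡k (suc i)
  size≡h∧prefix≡k-stable col b d b-blank i<d =
    cong₂ (λ s p → (s ≡ᵇ h) ∧ (p ≡ᵇ k)) (size-paint-other {col = col} b-blank (ℕ.>⇒≢ i<d))
          (prefixSize-paint-≥ {col = col} b-blank i (ℕ.<⇒≤ i<d))

  return-in-phase-i : ∀ col → Prob (return col) size≡h∧prefix≡k ≡ ind (prefix≡k col) * classSizeProb n h 0 (size col i)
  return-in-phase-i col = begin
    Prob (return col) size≡h∧prefix≡k           ≡⟨ Prob-return size≡h∧prefix≡k col ⟩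
    ind ((size col i ≡ᵇ h) ∧ prefix≡k col)      ≡⟨ ind-∧ (size col i ≡ᵇ h) (prefix≡k col) ⟩
    ind (size col i ≡ᵇ h) * ind (prefix≡k col)  ≡⟨ *-comm (ind (size col i ≡ᵇ h)) (ind (prefix≡k col)) ⟩
    ind (prefix≡k col) * ind (size col i ≡ᵇ h)  ∎
    where open ≡-Reasoning

  mutual
    run-in-phase-i : ∀ f col → length (uncolored col) ≤ f →
                     Prob (run f col i) size≡h∧prefix≡k
                       ≡ ind (prefix≡k col) * classSizeProb n h (length (uncolored col)) (size col i)
    run-in-phase-i zero    col u≤0 rewrite ℕ.n≤0⇒n≡0 u≤0 = return-in-phase-i col
    run-in-phase-i (suc f) col u≤1+f with uncolored col in eq
    ... | []     = return-in-phase-i col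
    ... | x ∷ xs = begin
      Prob (bind (uniform (allFin n)) (λ b → drawn f col i b (col b))) size≡h∧prefix≡k
        ≡⟨ Prob-bind-uniform size≡h∧prefix≡k (allFin n) _ ⟩
      frac 1 L * ∑ (allFin n) (λ b → Prob (drawn f col i b (col b)) size≡h∧prefix≡k)
        ≡⟨ cong (frac 1 L *_) (∑-cong {xs = allFin n} (All.tabulate (λ {b} _ →
             drawn-in-phase-i f col b (cong length eq) (ℕ.s≤s⁻¹ u≤1+f)))) ⟩
      frac 1 L * ∑ (allFin n) (λ b → if is-nothing (col b) then ind F * Q else ind (size≡h∧prefix≡k col))
        ≡⟨ mean-if (λ b → is-nothing (col b)) (ind F * Q) (ind (size≡h∧prefix≡k col)) (allFin n) ⟩
      frac (length (uncolored col)) L * (ind F * Q) + frac (L ∸ length (uncolored col)) L * ind ((s ≡ᵇ h) ∧ F)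
        ≡⟨ cong₂ (λ u L → frac u L * (ind F * Q) + frac (L ∸ u) L * ind ((s ≡ᵇ h) ∧ F))
                 (cong length eq) (length-tabulate {n = n} id) ⟩
      frac u n * (ind F * Q) + frac (n ∸ u) n * ind ((s ≡ᵇ h) ∧ F)
        ≡⟨ cong (λ e → frac u n * (ind F * Q) + frac (n ∸ u) n * e) (ind-∧ (s ≡ᵇ h) F) ⟩
      frac u n * (ind F * Q) + frac (n ∸ u) n * (ind (s ≡ᵇ h) * ind F)
        ≡⟨ solve 5 (λ a b f q e → a :* (f :* q) :+ b :* (e :* f) := f :* (a :* q :+ b :* e)) refl
                 (frac u n) (frac (n ∸ u) n) (ind F) Q (ind (s ≡ᵇ h)) ⟩
      ind F * (frac u n * Q + frac (n ∸ u) n * ind (s ≡ᵇ h)) ∎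
      where
      open ≡-Reasoning
      open +-*-Solver
      F = prefix≡k col
      s = size col i
      u = suc (length xs)
      L = length (allFin n)
      Q = classSizeProb n h (length xs) (suc s)

    drawn-in-phase-i : ∀ f col b {u} → length (uncolored col) ≡ suc u → u ≤ f →
                       Prob (drawn f col i b (col b)) size≡h∧prefix≡k
                         ≡ (if is-nothing (col b) then ind (prefix≡k col) * classSizeProb n h u (suc (size col i))
                                                  else ind (size≡h∧prefix≡k col))
    drawn-in-phase-i f col b {u} u≡1+u u≤f with col b in b-colour
    ... | just _  = openColour-stable size≡h∧prefix≡k-stable f col
                      (λ u≡[] → ℕ.0≢1+n (trans (sym (cong length u≡[])) u≡1+u))
    ... | nothing = begin
      Prob (run f col′ i) size≡h∧prefix≡k
        ≡⟨ run-in-phase-i f col′ (subst (_≤ f) (sym u′≡u) u≤f) ⟩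
      ind (prefix≡k col′) * classSizeProb n h (length (uncolored col′)) (size col′ i)
        ≡⟨ cong₂ (λ p u′ → ind p * classSizeProb n h u′ (size col′ i)) (prefix≡k-stable col b i b-colour ℕ.≤-refl) u′≡u ⟩
      ind (prefix≡k col) * classSizeProb n h u (size col′ i)
        ≡⟨ cong (λ s′ → ind (prefix≡k col) * classSizeProb n h u s′) (size-paint-self {col = col} i b-colour) ⟩
      ind (prefix≡k col) * classSizeProb n h u (suc (size col i)) ∎
      where
      open ≡-Reasoning
      col′ = paint col b i
      u′≡u : length (uncolored col′) ≡ u
      u′≡u = ℕ.suc-injective (trans (sym (length-uncolored-paint {col = col} i b-colour)) u≡1+u)

-- Propagating the proportionality back to the start

module Proportionality {n : ℕ} .{{_ : NonZero n}} (i k h : ℕ) (k<n : k < n) (0<h : 0 < h) (h≤n∸k : h ≤ n ∸ k) where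

  open Events {n} i k h

  Proportional : Dist (Coloring n) → Set
  Proportional d = Prob d size≡h∧prefix≡k ≡ formula n k h * Prob d prefix≡k

  finished-before-i-∝ : ∀ {col j} → j < i → ColoursBelow col (suc j) → prefixSize col (suc j) ≡ n → Proportional (return col)
  finished-before-i-∝ {col} {j} j<i below all-coloured = begin
    Prob (return col) size≡h∧prefix≡k   ≡⟨ Prob-return size≡h∧prefix≡k col ⟩
    ind (size≡h∧prefix≡k col)           ≡⟨ cong ind (trans (cong ((size col i ≡ᵇ h) ∧_) prefix≢k) (∧-zeroʳ _)) ⟩
    0ℚ                                  ≡⟨ *-zeroʳ (formula n k h) ⟨
    formula n k h * ind false           ≡⟨ cong (λ b → formula n k h * ind b) prefix≢k ⟨
    formula n k h * ind (prefix≡k col)  ≡⟨ cong (formula n k h *_) (Prob-return prefix≡k col) ⟨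
    formula n k h * Prob (return col) prefix≡k ∎
    where
    open ≡-Reasoning
    prefix≡n : prefixSize col i ≡ n
    prefix≡n = begin
      prefixSize col i                       ≡⟨ cong (prefixSize col) (ℕ.m∸n+n≡m j<i) ⟨
      prefixSize col (i ∸ suc j ℕ.+ suc j)   ≡⟨ prefixSize-≥ below (i ∸ suc j) ⟩
      prefixSize col (suc j)                 ≡⟨ all-coloured ⟩
      n                                      ∎
    prefix≢k : prefix≡k col ≡ false
    prefix≢k = trans (cong (_≡ᵇ k) prefix≡n) (≢⇒≡ᵇ≡false (ℕ.>⇒≢ k<n))

  opening-i-∝ : ∀ f {col a} → ColoursBelow col i → Partition col i → col a ≡ nothing →
             length (uncolored col) ≤ suc f → Proportional (run f (paint col a i) i)
  opening-i-∝ f {col} {a} below partition a-blank fuel = begin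
    Prob (run f col′ i) size≡h∧prefix≡k
      ≡⟨ run-in-phase-i f col′ (length-uncolored-paint-≤ {col = col} i a-blank fuel) ⟩
    ind (prefix≡k col′) * classSizeProb n h u′ (size col′ i)
      ≡⟨ cong (λ s → ind (prefix≡k col′) * classSizeProb n h u′ s) size≡1 ⟩
    ind (prefix≡k col′) * classSizeProb n h u′ 1
      ≡⟨ ind-guarded (prefix≡k col′) (λ prefix≡k → classSizeProb≡formula n k h u′ (k+1+u′≡n prefix≡k) 0<h h≤n∸k) ⟩
    formula n k h * ind (prefix≡k col′)
      ≡⟨ cong (formula n k h *_) (run-stable prefix≡k-stable f col′) ⟨
    formula n k h * Prob (run f col′ i) prefix≡k ∎
    where
    open ≡-Reasoning
    col′ = paint col a i
    u′ = length (uncolored col′)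
    size≡1 : size col′ i ≡ 1
    size≡1 = trans (size-paint-self {col = col} i a-blank) (cong suc (size-≥ below ℕ.≤-refl))
    k+1+u′≡n : prefix≡k col′ ≡ true → k ℕ.+ suc u′ ≡ n
    k+1+u′≡n prefix≡k = begin
      k ℕ.+ suc u′                                  ≡⟨ cong (ℕ._+ suc u′) (ℕ.≡ᵇ⇒≡ _ k (subst T (sym prefix≡k) _)) ⟨
      prefixSize col′ i ℕ.+ suc u′                  ≡⟨ cong₂ ℕ._+_ (prefixSize-paint-≥ {col = col} a-blank i ℕ.≤-refl)
                                                                 (sym (length-uncolored-paint {col = col} i a-blank)) ⟩
      prefixSize col i ℕ.+ length (uncolored col)   ≡⟨ partition ⟩
      n ∎

  mutual
    run-∝ : ∀ f {col j} → j < i → ColoursBelow col (suc j) → Partition col (suc j) →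
            length (uncolored col) ≤ f → Proportional (run f col j)
    run-∝ zero {col} {j} j<i below partition fuel = finished-before-i-∝ {col} j<i below
      (trans (sym (ℕ.+-identityʳ _)) (trans (cong (prefixSize col (suc j) ℕ.+_) (sym (ℕ.n≤0⇒n≡0 fuel))) partition))
    run-∝ (suc f) {col} {j} j<i below partition fuel with uncolored col in eq
    ... | []    = finished-before-i-∝ {col} j<i below (trans (sym (ℕ.+-identityʳ _)) partition)
    ... | _ ∷ _ = Prob-bind-uniform-∝ size≡h∧prefix≡k prefix≡k (formula n k h) {xs = allFin n}
                    (All.tabulate (λ {b} _ → drawn-∝ f b j<i below partition′ fuel′))
      where
      partition′ : Partition col (suc j)
      partition′ = subst (λ u → prefixSize col (suc j) ℕ.+ length u ≡ n) (sym eq) partition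
      fuel′ : length (uncolored col) ≤ suc f
      fuel′ = subst (λ u → length u ≤ suc f) (sym eq) fuel

    drawn-∝ : ∀ f {col j} b → j < i → ColoursBelow col (suc j) → Partition col (suc j) →
              length (uncolored col) ≤ suc f → Proportional (drawn f col j b (col b))
    drawn-∝ f {col} {j} b j<i below partition fuel with col b in b-colour
    ... | nothing = run-∝ f j<i (ColoursBelow-paint (ℕ.n<1+n j) below)
                              (Partition-paint {col = col} b-colour (ℕ.n<1+n j) partition)
                              (length-uncolored-paint-≤ {col = col} j b-colour fuel)
    ... | just _  = openColour-∝ f j<i below partition fuel

    openColour-∝ : ∀ f {col j} → j < i → ColoursBelow col (suc j) → Partition col (suc j) →
                   length (uncolored col) ≤ suc f → Proportional (openColour f col j)
    openColour-∝ f {col} {j} j<i below partition fuel =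
      Prob-bind-uniform-∝ size≡h∧prefix≡k prefix≡k (formula n k h) (All.map new-colour-∝ (uncolored-blank col))
      where
      new-colour-∝ : ∀ {a} → col a ≡ nothing → Proportional (run f (paint col a (suc j)) (suc j))
      new-colour-∝ {a} a-blank with ℕ.m≤n⇒m<n∨m≡n j<i
      ... | inj₁ 1+j<i = run-∝ f 1+j<i (ColoursBelow-paint (ℕ.n<1+n (suc j)) (ColoursBelow-mono (ℕ.n≤1+n (suc j)) below))
                                      (Partition-paint {col = col} a-blank (ℕ.n<1+n (suc j)) (Partition-≥ below partition 1))
                                      (length-uncolored-paint-≤ {col = col} (suc j) a-blank fuel)
      ... | inj₂ 1+j≡i = subst (λ c → Proportional (run f (paint col a c) c)) (sym 1+j≡i)
                           (opening-i-∝ f (subst (ColoursBelow col) 1+j≡i below) (subst (Partition col) 1+j≡i partition) a-blank fuel)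

lemma2 : (n : ℕ) → 2 ≤ n → (r : Fin n) → (i k h : ℕ) → 0 < i →
         1 ≤ k → k ≤ n ∸ 1 → 1 ≤ h → h ≤ n ∸ k →
         Prob (process n r) (λ col → (size col i ≡ᵇ h) ∧ (prefixSize col i ≡ᵇ k))
           ≡ formula n k h * Prob (process n r) (λ col → prefixSize col i ≡ᵇ k)
lemma2 (suc zero) (ℕ.s≤s ())
lemma2 n@(suc (suc _)) _ r i k h 0<i _ k≤n∸1 0<h h≤n∸k =
  openColour-∝ n {paint blank r 0} 0<i (ColoursBelow-paint {b = r} ℕ.z<s (λ _ ()))
    (Partition-paint {col = blank} {b = r} {J = 1} refl ℕ.z<s blank-partition) fuel
  where
  open Proportionality i k h (ℕ.s≤s k≤n∸1) 0<h h≤n∸k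
  blank : Coloring n
  blank _ = nothing
  blank-partition : Partition blank 1
  blank-partition = Partition-≥ {col = blank} {J = 0} (λ _ ())
    (trans (cong length (filter-all (λ _ → T? true) {allFin n} (All.tabulate _))) (length-tabulate id)) 1
  fuel : length (uncolored (paint blank r 0)) ≤ suc n
  fuel = ℕ.m≤n⇒m≤1+n (ℕ.≤-trans (length-filter (λ x → T? (is-nothing (paint blank r 0 x))) (allFin n))
                                (ℕ.≤-reflexive (length-tabulate id)))
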